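{- Let $q\in\mathbb{N}$ and let $(\vec{H},h)$ be a $q$-coloured in-orientation of a graph $H$. Let $\vec{G}$ be an orientation of a graph $G$ and let $\psi$ be an out-neighbourhood bijective homomorphism from $\vec{G}$ to $\vec{H}$. Then $(\vec{G},h\circ\psi)$ is a $q$-coloured in-orientation of $G$.
   Context: Graphs are finite and simple. A $q$-colouring of $G$ is a map $V(G)\to\mathbb{Z}_q$ assigning distinct colours to adjacent vertices. For an orientation $\vec{G}$ of $G$ and a $q$-colouring $f$ of $G$, $(\vec{G},f)$ is a $q$-coloured in-orientation if for every vertex $v$: (i) no out-neighbour of $v$ has the same colour as an in-neighbour of $v$, and (ii) the out-neighbours of $v$ have pairwise distinct colours. An out-neighbourhood bijective homomorphism from $\vec{G}$ to $\vec{H}$ is a map $\psi\colon V(\vec{G})\to V(\vec{H})$ such that for every vertex $v$ the restriction of $\psi$ to $N^+_{\vec{G}}(v)$ is a bijection onto $N^+_{\vec{H}}(\psi(v))$. -}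

module Defs where

open import Data.Nat using (ℕ)
open import Data.Fin using (Fin)
open import Data.Sum using (_⊎_)
open import Data.Product using (_×_; ∃-syntax)
open import Relation.Nullary using (¬_)
open import Relation.Binary.PropositionalEquality using (_≡_; _≢_)
open import Level using (0ℓ; suc)

record Graph (n : ℕ) : Set₁ where
  field
    Adj     : Fin n → Fin n → Set
    sym     : ∀ {u v} → Adj u v → Adj v u
    irrefl  : ∀ {u} → ¬ Adj u u
open Graph public

-- An orientation of G: each edge uv receives exactly one direction;
-- Arc u v means u → v (v is an out-neighbour of u).
record Orientation {n : ℕ} (G : Graph n) : Set₁ where
  field
    Arc        : Fin n → Fin n → Set
    arc⇒adj    : ∀ {u v} → Arc u v → Adj G u v
    adj⇒arc    : ∀ {u v} → Adj G u v → Arc u v ⊎ Arc v u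
    antisym    : ∀ {u v} → Arc u v → ¬ Arc v u
open Orientation public

IsColouring : {n : ℕ} (q : ℕ) (G : Graph n) → (Fin n → Fin q) → Set
IsColouring q G f = ∀ {u v} → Adj G u v → f u ≢ f v

record IsColouredInOrientation {n : ℕ} (q : ℕ) (G : Graph n)
         (O : Orientation G) (f : Fin n → Fin q) : Set where
  field
    colouring  : IsColouring q G f
    out≢in     : ∀ {v w u} → Arc O v w → Arc O u v → f w ≢ f u
    out-distinct : ∀ {v w w'} → Arc O v w → Arc O v w' → w ≢ w' → f w ≢ f w'

record IsOutNbhdBijHom {n m : ℕ} {G : Graph n} {H : Graph m}
         (OG : Orientation G) (OH : Orientation H) (ψ : Fin n → Fin m) : Set where
  field
    maps-into  : ∀ {v w} → Arc OG v w → Arc OH (ψ v) (ψ w)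
    injective  : ∀ {v w w'} → Arc OG v w → Arc OG v w' → ψ w ≡ ψ w' → w ≡ w'
    surjective : ∀ {v x} → Arc OH (ψ v) x → ∃[ w ] (Arc OG v w × ψ w ≡ x)

{-# OPTIONS --safe #-}
module Submission where

open import Defs
open import Data.Nat using (ℕ)
open import Data.Fin using (Fin; _≟_)
open import Data.Sum using (inj₁; inj₂)
open import Function using (_∘_)
open import Relation.Binary.PropositionalEquality using (_≡_; _≢_; ≢-sym)
open import Relation.Nullary using (yes; no)

module _ {n m : ℕ} {G : Graph n} {H : Graph m}
         (OG : Orientation G) (OH : Orientation H) {ψ : Fin n → Fin m}
         (arc-preserving : ∀ {v w} → Arc OG v w → Arc OH (ψ v) (ψ w))
         {q : ℕ} {h : Fin m → Fin q} where

  colouring-pullback : IsColouring q H h → IsColouring q G (h ∘ ψ)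
  colouring-pullback col e with adj⇒arc OG e
  ... | inj₁ vw = col (arc⇒adj OH (arc-preserving vw))
  ... | inj₂ wv = ≢-sym (col (arc⇒adj OH (arc-preserving wv)))

  out≢in-pullback : (∀ {v w u} → Arc OH v w → Arc OH u v → h w ≢ h u) →
                    ∀ {v w u} → Arc OG v w → Arc OG u v → h (ψ w) ≢ h (ψ u)
  out≢in-pullback out≢in vw uv = out≢in (arc-preserving vw) (arc-preserving uv)

  out-distinct-pullback :
    (∀ {v w w'} → Arc OG v w → Arc OG v w' → ψ w ≡ ψ w' → w ≡ w') →
    (∀ {v w w'} → Arc OH v w → Arc OH v w' → w ≢ w' → h w ≢ h w') →
    ∀ {v w w'} → Arc OG v w → Arc OG v w' → w ≢ w' → h (ψ w) ≢ h (ψ w')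
  out-distinct-pullback locally-injective out-distinct {w = w} {w'} vw vw' w≢w'
    with ψ w ≟ ψ w'
  ... | yes ψw≡ψw' = λ _ → w≢w' (locally-injective vw vw' ψw≡ψw')
  ... | no ψw≢ψw' = out-distinct (arc-preserving vw) (arc-preserving vw') ψw≢ψw'

theorem3 : (q : ℕ) {n m : ℕ} (G : Graph n) (H : Graph m)
           (OG : Orientation G) (OH : Orientation H)
           (h : Fin m → Fin q) (ψ : Fin n → Fin m) →
           IsColouredInOrientation q H OH h →
           IsOutNbhdBijHom OG OH ψ →
           IsColouredInOrientation q G OG (h ∘ ψ)
theorem3 q G H OG OH h ψ coloured hom = record
  { colouring    = colouring-pullback OG OH maps-into colouring
  ; out≢in       = out≢in-pullback OG OH maps-into out≢in
  ; out-distinct = out-distinct-pullback OG OH maps-into injective out-distinct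
  }
  where
    open IsColouredInOrientation coloured
    open IsOutNbhdBijHom hom using (maps-into; injective)
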